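{- Let $s\ge 2$ be an integer and $T$ a tree whose diameter is strictly greater than $s$. Then every inclusion-maximal $s$-clique of $T$ is of the form $\overline{B}(u,s/2)$ for some vertex $u\in V_T$ if $s$ is even, and of the form $\overline{B}(u,(s-1)/2)\cup\overline{B}(v,(s-1)/2)$ for some edge $\{u,v\}\in E_T$ if $s$ is odd.
   Context: For a graph $G$, a set $S\subseteq V_G$ is an $s$-clique if $\operatorname{dist}_G(u,v)\le s$ for all $u,v\in S$. For a vertex $u$ and $r\ge 0$, $\overline{B}(u,r)=\{v\in V_T:\operatorname{dist}_T(u,v)\le r\}$ is the closed ball. The diameter of a connected graph is the maximum distance between two of its vertices. -}

module Defs where

open import Data.Nat using (ℕ; zero; suc; _≤_; _+_)
open import Data.Fin using (Fin)
open import Data.Bool using (Bool; true; false)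
open import Data.List using (List; []; _∷_)
open import Data.List.Relation.Unary.Unique.Propositional using (Unique)
open import Data.Fin.Subset using (Subset; _∈_; _⊆_)
open import Data.Product using (Σ; ∃; ∃-syntax; _×_; _,_)
open import Relation.Binary.PropositionalEquality using (_≡_)
open import Relation.Nullary using (¬_)
open import Data.Empty using (⊥)

record Graph (n : ℕ) : Set where
  field
    adj    : Fin n → Fin n → Bool
    sym    : ∀ u v → adj u v ≡ adj v u
    irrefl : ∀ u → adj u u ≡ false

module _ {n : ℕ} (G : Graph n) where
  open Graph G

  Adj : Fin n → Fin n → Set
  Adj u v = adj u v ≡ true

  data Walk : Fin n → Fin n → Set where
    here : ∀ {u} → Walk u u
    step : ∀ {u v w} → Adj u v → Walk v w → Walk u w

  len : ∀ {u v} → Walk u v → ℕ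
  len here       = zero
  len (step _ p) = suc (len p)

  vertices : ∀ {u v} → Walk u v → List (Fin n)
  vertices {u} here       = u ∷ []
  vertices {u} (step _ p) = u ∷ vertices p

  IsPath : ∀ {u v} → Walk u v → Set
  IsPath p = Unique (vertices p)

  DistLe : Fin n → Fin n → ℕ → Set
  DistLe u v r = Σ (Walk u v) λ p → len p ≤ r

  Connected : Set
  Connected = ∀ u v → Walk u v

  Acyclic : Set
  Acyclic = ∀ u v (p : Walk u v) → IsPath p → 2 ≤ len p → Adj v u → ⊥

  IsTree : Set
  IsTree = Connected × Acyclic

  DiameterGt : ℕ → Set
  DiameterGt s = ∃[ u ] ∃[ v ] ¬ DistLe u v s

  IsSClique : ℕ → Subset n → Set
  IsSClique s S = ∀ u v → u ∈ S → v ∈ S → DistLe u v s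

  IsMaximalSClique : ℕ → Subset n → Set
  IsMaximalSClique s S =
    IsSClique s S × (∀ S' → IsSClique s S' → S ⊆ S' → S' ⊆ S)

  InBall : Fin n → ℕ → Fin n → Set
  InBall u r x = DistLe u x r

module Submission where

-- Every edge uw of a tree separates the vertices nearer to u from those nearer to w, and uw is the
-- only edge between the two sides, because a closed walk in a tree traverses every edge an even
-- number of times.  So if an s-clique S lies in the ball of radius m + 1 about c, where s ≤ 2m, and
-- x₀ ∈ S is at distance m + 1, stepping from c to its neighbour w toward x₀ leaves S inside the ball
-- of radius m about w: a point x ∈ S on c's side is reached from x₀ only through the edge, so
-- m + 1 + d(c,x) ≤ d(x₀,x) ≤ s.  Shrinking from radius s gives a ball of radius ⌈s/2⌉ containing S;
-- for odd s = 2k + 1 one more such step puts S inside B̄(c,k) ∪ B̄(w,k) with c, w adjacent.  The ball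
-- B̄(c,s/2), resp. that union, is itself an s-clique, so by maximality it equals S.

open import Defs
open import Data.Nat using (ℕ; _≤_; _+_; _*_)
open import Data.Fin using (Fin)
open import Data.Fin.Subset using (Subset; _∈_)
open import Data.Product using (_×_; ∃-syntax)
open import Data.Sum using (_⊎_)
open import Relation.Binary.PropositionalEquality using (_≡_)
open import Function.Bundles using (_⇔_)

open import Data.Nat using (zero; suc; _<_; z≤n; s≤s)
open import Data.Nat.Properties
open import Data.Nat.Divisibility using (_∣_; _∣0; ∣m∣n⇒∣m+n; ∣m+n∣m⇒∣n; ∣1⇒≡1; m∣m*n)
open import Data.Fin using () renaming (_≟_ to _≟ᶠ_)
open import Data.Fin.Properties using (any?)
open import Data.Fin.Subset.Properties using (_∈?_)
open import Data.Vec using (tabulate)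
open import Data.Vec.Properties using (lookup∘tabulate; []=⇒lookup; lookup⇒[]=)
open import Data.Bool using (true)
open import Data.Bool.Properties using (T-≡) renaming (_≟_ to _≟ᵇ_)
open import Data.Product using (Σ; _,_; proj₁; proj₂)
open import Data.Sum using (inj₁; inj₂; [_,_]′) renaming (map to ⊎-map)
open import Data.Empty using (⊥-elim)
open import Data.List.Relation.Unary.Any using (here; there)
import Data.List.Relation.Unary.All as All
open import Data.List.Relation.Unary.All.Properties.Core using (¬Any⇒All¬)
open import Data.List.Relation.Unary.AllPairs.Core using ([]; _∷_)
open import Relation.Nullary using (¬_; Dec; yes; no; contradiction)
open import Relation.Nullary.Decidable using (map′; isYes; toWitness; fromWitness; _×-dec_; _⊎-dec_)
open import Relation.Binary.Definitions using (tri<; tri≈; tri>)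
open import Relation.Binary.PropositionalEquality
  using (_≢_; refl; sym; trans; cong; cong₂; subst; subst₂; module ≡-Reasoning)
open import Function.Base using (id; _∘_)
open import Function.Bundles using (mk⇔; Equivalence)
open import Algebra.Properties.CommutativeSemigroup +-commutativeSemigroup using (x∙yz≈y∙xz)

2*m≡m+m : ∀ m → 2 * m ≡ m + m
2*m≡m+m m = cong (m +_) (+-identityʳ m)

2*m+1≡m+[1+m] : ∀ m → 2 * m + 1 ≡ m + suc m
2*m+1≡m+[1+m] m = begin
  2 * m + 1    ≡⟨ cong (_+ 1) (2*m≡m+m m) ⟩
  m + m + 1    ≡⟨ +-assoc m m 1 ⟩
  m + (m + 1)  ≡⟨ cong (m +_) (+-comm m 1) ⟩
  m + suc m    ∎
  where open ≡-Reasoning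

2∣m+m : ∀ m → 2 ∣ m + m
2∣m+m m = subst (2 ∣_) (2*m≡m+m m) (m∣m*n m)

2∤1+m+m : ∀ m → ¬ 2 ∣ suc (m + m)
2∤1+m+m m 2∣1+m+m = contradiction (∣1⇒≡1 (∣m+n∣m⇒∣n 2∣m+m+1 (2∣m+m m))) λ ()
  where
  2∣m+m+1 : 2 ∣ m + m + 1
  2∣m+m+1 = subst (2 ∣_) (+-comm 1 (m + m)) 2∣1+m+m

least : ∀ {P : ℕ → Set} → (∀ m → Dec (P m)) → (∀ {i j} → i ≤ j → P i → P j) →
        ∀ {k} → P k → ∃[ m ] (P m × ∀ {j} → P j → m ≤ j)
least P? up {zero} p = 0 , p , λ _ → z≤n
least P? up {suc k} p with P? k
... | yes pk = least P? up pk
... | no ¬pk = suc k , p , λ pj → ≰⇒> λ j≤k → ¬pk (up j≤k pj)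

module Walks {n : ℕ} (G : Graph n) where
  open Graph G using (adj) renaming (sym to adj-comm)
  open import Data.List.Membership.DecPropositional (_≟ᶠ_ {n})
    using () renaming (_∈_ to _∈ᴸ_; _∈?_ to _∈ᴸ?_)

  Adj-sym : ∀ {a b} → Adj G a b → Adj G b a
  Adj-sym {a} {b} e = trans (adj-comm b a) e

  infixr 5 _++_
  _++_ : ∀ {a b c} → Walk G a b → Walk G b c → Walk G a c
  here ++ q = q
  step e p ++ q = step e (p ++ q)

  reverse : ∀ {a b} → Walk G a b → Walk G b a
  reverse here = here
  reverse (step e p) = reverse p ++ step (Adj-sym e) here

  len-++ : ∀ {a b c} (p : Walk G a b) (q : Walk G b c) → len G (p ++ q) ≡ len G p + len G q
  len-++ here q = refl
  len-++ (step e p) q = cong suc (len-++ p q)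

  len-reverse : ∀ {a b} (p : Walk G a b) → len G (reverse p) ≡ len G p
  len-reverse here = refl
  len-reverse (step e p) = begin
    len G (reverse p ++ step _ here)  ≡⟨ len-++ (reverse p) _ ⟩
    len G (reverse p) + 1             ≡⟨ +-comm _ 1 ⟩
    suc (len G (reverse p))           ≡⟨ cong suc (len-reverse p) ⟩
    suc (len G p)                     ∎
    where open ≡-Reasoning

  weight : (Fin n → Fin n → ℕ) → ∀ {a b} → Walk G a b → ℕ
  weight f here = 0
  weight f (step {a} {v} _ p) = f a v + weight f p

  weight-++ : ∀ f {a b c} (p : Walk G a b) (q : Walk G b c) →
              weight f (p ++ q) ≡ weight f p + weight f q
  weight-++ f here q = refl
  weight-++ f (step {a} {v} _ p) q =
    trans (cong (f a v +_) (weight-++ f p q)) (sym (+-assoc (f a v) _ _))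

  len≡weight : ∀ {a b} (p : Walk G a b) → len G p ≡ weight (λ _ _ → 1) p
  len≡weight here = refl
  len≡weight (step _ p) = cong suc (len≡weight p)

  DistLe-mono : ∀ {a b r r′} → DistLe G a b r → r ≤ r′ → DistLe G a b r′
  DistLe-mono (p , p≤r) r≤r′ = p , ≤-trans p≤r r≤r′

  DistLe-++ : ∀ {a b c r r′} → DistLe G a b r → DistLe G b c r′ → DistLe G a c (r + r′)
  DistLe-++ (p , p≤r) (q , q≤r′) =
    p ++ q , ≤-trans (≤-reflexive (len-++ p q)) (+-mono-≤ p≤r q≤r′)

  DistLe-sym : ∀ {a b r} → DistLe G a b r → DistLe G b a r
  DistLe-sym (p , p≤r) = reverse p , ≤-trans (≤-reflexive (len-reverse p)) p≤r

  DistLe? : ∀ r a b → Dec (DistLe G a b r)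
  DistLe? zero a b =
    map′ (λ { refl → here , z≤n }) (λ { (here , _) → refl ; (step _ _ , ()) }) (a ≟ᶠ b)
  DistLe? (suc r) a b =
    map′ to from (a ≟ᶠ b ⊎-dec any? (λ v → (adj a v ≟ᵇ true) ×-dec DistLe? r v b))
    where
    to : a ≡ b ⊎ ∃[ v ] (Adj G a v × DistLe G v b r) → DistLe G a b (suc r)
    to (inj₁ refl) = here , z≤n
    to (inj₂ (v , e , p , p≤r)) = step e p , s≤s p≤r
    from : DistLe G a b (suc r) → a ≡ b ⊎ ∃[ v ] (Adj G a v × DistLe G v b r)
    from (here , _) = inj₁ refl
    from (step e p , s≤s p≤r) = inj₂ (_ , e , p , p≤r)

  first-edge : ∀ {a b} → Walk G a b → a ≢ b → ∃[ w ] Adj G a w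
  first-edge here a≢a = contradiction refl a≢a
  first-edge (step e _) _ = _ , e

  source-∈ : ∀ {a b} (p : Walk G a b) → a ∈ᴸ vertices G p
  source-∈ here = here refl
  source-∈ (step _ _) = here refl

  split-at-vertex : ∀ {a b v} (p : Walk G a b) → v ∈ᴸ vertices G p →
                    Σ (Walk G a v) λ q → Σ (Walk G v b) λ r → p ≡ q ++ r
  split-at-vertex here (here refl) = here , here , refl
  split-at-vertex (step e p) (here refl) = here , step e p , refl
  split-at-vertex (step e p) (there v∈p) with split-at-vertex p v∈p
  ... | q , r , p≡ = step e q , r , cong (step e) p≡

  visits⇒DistLe : ∀ {a b v} (p : Walk G a b) → v ∈ᴸ vertices G p →
                  DistLe G a v (len G p) × DistLe G v b (len G p)
  visits⇒DistLe p v∈p with split-at-vertex p v∈p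
  ... | q , r , p≡ = (q , ≤-trans (m≤m+n _ _) len≥) , (r , ≤-trans (m≤n+m _ _) len≥)
    where
    len≥ : len G q + len G r ≤ len G p
    len≥ = ≤-reflexive (sym (trans (cong (len G) p≡) (len-++ q r)))

  record Detour {a b} (p : Walk G a b) : Set where
    field
      corner : Fin n
      loop : Walk G corner corner
      rest : Walk G a b
      loop-nonempty : 1 ≤ len G loop
      weight-split : ∀ f → weight f p ≡ weight f loop + weight f rest

    len-split : len G p ≡ len G loop + len G rest
    len-split = begin
      len G p                        ≡⟨ len≡weight p ⟩
      weight _ p                     ≡⟨ weight-split _ ⟩
      weight _ loop + weight _ rest  ≡⟨ sym (cong₂ _+_ (len≡weight loop) (len≡weight rest)) ⟩
      len G loop + len G rest        ∎
      where open ≡-Reasoning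

  path-or-detour : ∀ {a b} (p : Walk G a b) → IsPath G p ⊎ Detour p
  path-or-detour here = inj₁ (All.[] ∷ [])
  path-or-detour {a} (step {v = v} e p) with path-or-detour p
  ... | inj₂ d = inj₂ (record
    { corner = corner ; loop = loop ; rest = step e rest ; loop-nonempty = loop-nonempty
    ; weight-split = λ f → trans (cong (f a v +_) (weight-split f))
                                 (x∙yz≈y∙xz (f a v) (weight f loop) (weight f rest)) })
    where open Detour d
  ... | inj₁ path with a ∈ᴸ? vertices G p
  ...   | no a∉p = inj₁ (¬Any⇒All¬ _ a∉p ∷ path)
  ...   | yes a∈p with split-at-vertex p a∈p
  ...     | q , r , p≡ = inj₂ (record
    { corner = a ; loop = step e q ; rest = r ; loop-nonempty = s≤s z≤n
    ; weight-split = λ f → trans (cong (f a v +_) (trans (cong (weight f) p≡) (weight-++ f q r)))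
                                 (sym (+-assoc (f a v) _ _)) })

  Joins : Fin n → Fin n → Fin n → Fin n → Set
  Joins u w a b = (a ≡ u × b ≡ w) ⊎ (a ≡ w × b ≡ u)

  Joins? : ∀ u w a b → Dec (Joins u w a b)
  Joins? u w a b = ((a ≟ᶠ u) ×-dec (b ≟ᶠ w)) ⊎-dec ((a ≟ᶠ w) ×-dec (b ≟ᶠ u))

  Joins-swap : ∀ {u w a b} → Joins u w a b → Joins u w b a
  Joins-swap (inj₁ (a≡u , b≡w)) = inj₂ (b≡w , a≡u)
  Joins-swap (inj₂ (a≡w , b≡u)) = inj₁ (b≡u , a≡w)

  crossings : Fin n → Fin n → Fin n → Fin n → ℕ
  crossings u w a b with Joins? u w a b
  ... | yes _ = 1
  ... | no _ = 0

  crossings-sym : ∀ u w a b → crossings u w a b ≡ crossings u w b a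
  crossings-sym u w a b with Joins? u w a b | Joins? u w b a
  ... | yes _ | yes _ = refl
  ... | no _ | no _ = refl
  ... | yes J | no ¬J = contradiction (Joins-swap J) ¬J
  ... | no ¬J | yes J = contradiction (Joins-swap J) ¬J

  crossings-Joins : ∀ {u w a b} → Joins u w a b → crossings u w a b ≡ 1
  crossings-Joins {u} {w} {a} {b} J with Joins? u w a b
  ... | yes _ = refl
  ... | no ¬J = contradiction J ¬J

  crossings-¬Joins : ∀ {u w a b} → ¬ Joins u w a b → crossings u w a b ≡ 0
  crossings-¬Joins {u} {w} {a} {b} ¬J with Joins? u w a b
  ... | yes J = contradiction J ¬J
  ... | no _ = refl

  uncrossed-or-visits : ∀ u w {a b} (p : Walk G a b) →
    weight (crossings u w) p ≡ 0 ⊎ (u ∈ᴸ vertices G p × w ∈ᴸ vertices G p)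
  uncrossed-or-visits u w here = inj₁ refl
  uncrossed-or-visits u w (step {a} {v} e p) with Joins? u w a v
  ... | yes (inj₁ (refl , refl)) = inj₂ (here refl , there (source-∈ p))
  ... | yes (inj₂ (refl , refl)) = inj₂ (there (source-∈ p) , here refl)
  ... | no _ =
    ⊎-map id (λ (u∈p , w∈p) → there u∈p , there w∈p) (uncrossed-or-visits u w p)

module Cliques {n : ℕ} (G : Graph n) where
  open Walks G

  ball-DistLe : ∀ {c k x y} → InBall G c k x → InBall G c k y → DistLe G x y (k + k)
  ball-DistLe cx cy = DistLe-++ (DistLe-sym cx) cy

  adjacent-balls-DistLe : ∀ {u v k x y} → Adj G u v →
    InBall G u k x ⊎ InBall G v k x → InBall G u k y ⊎ InBall G v k y →
    DistLe G x y (k + suc k)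
  adjacent-balls-DistLe {k = k} e (inj₁ ux) (inj₁ uy) =
    DistLe-mono (ball-DistLe ux uy) (+-monoʳ-≤ k (n≤1+n k))
  adjacent-balls-DistLe e (inj₁ ux) (inj₂ vy) =
    DistLe-++ (DistLe-sym ux) (DistLe-++ (step e here , s≤s z≤n) vy)
  adjacent-balls-DistLe e (inj₂ vx) (inj₁ uy) =
    DistLe-sym (adjacent-balls-DistLe e (inj₁ uy) (inj₂ vx))
  adjacent-balls-DistLe {k = k} e (inj₂ vx) (inj₂ vy) =
    DistLe-mono (ball-DistLe vx vy) (+-monoʳ-≤ k (n≤1+n k))

  maximal-clique-⇔ : ∀ {s S} → IsMaximalSClique G s S →
    {P : Fin n → Set} → (∀ x → Dec (P x)) → (∀ x y → P x → P y → DistLe G x y s) →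
    (∀ x → x ∈ S → P x) → ∀ x → (x ∈ S) ⇔ P x
  maximal-clique-⇔ {s} {S} (_ , maximal) {P} P? P-clique S⊆P x =
    mk⇔ (S⊆P x) (λ px → maximal B B-clique (λ {y} y∈S → ∈B⁺ (S⊆P y y∈S)) (∈B⁺ px))
    where
    B : Subset n
    B = tabulate (λ y → isYes (P? y))
    ∈B⁺ : ∀ {y} → P y → y ∈ B
    ∈B⁺ {y} py = lookup⇒[]= y B
      (trans (lookup∘tabulate _ y) (Equivalence.to T-≡ (fromWitness {a? = P? y} py)))
    ∈B⁻ : ∀ {y} → y ∈ B → P y
    ∈B⁻ {y} y∈B = toWitness {a? = P? y}
      (Equivalence.from T-≡ (trans (sym (lookup∘tabulate _ y)) ([]=⇒lookup y∈B)))
    B-clique : IsSClique G s B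
    B-clique y z y∈B z∈B = P-clique y z (∈B⁻ y∈B) (∈B⁻ z∈B)

  maximal-clique-ball : ∀ {s S c k} → IsMaximalSClique G s S → s ≡ k + k →
    (∀ x → x ∈ S → InBall G c k x) → ∀ x → (x ∈ S) ⇔ InBall G c k x
  maximal-clique-ball {c = c} {k} maximal s≡ S⊆B = maximal-clique-⇔ maximal (DistLe? k c)
    (λ x y cx cy → subst (DistLe G x y) (sym s≡) (ball-DistLe cx cy)) S⊆B

  maximal-clique-adjacent-balls : ∀ {s S u v k} → IsMaximalSClique G s S → s ≡ k + suc k →
    Adj G u v → (∀ x → x ∈ S → InBall G u k x ⊎ InBall G v k x) →
    ∀ x → (x ∈ S) ⇔ (InBall G u k x ⊎ InBall G v k x)
  maximal-clique-adjacent-balls {u = u} {v} {k} maximal s≡ e S⊆B∪B′ =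
    maximal-clique-⇔ maximal (λ x → DistLe? k u x ⊎-dec DistLe? k v x)
      (λ x y x∈B∪B′ y∈B∪B′ → subst (DistLe G x y) (sym s≡) (adjacent-balls-DistLe e x∈B∪B′ y∈B∪B′))
      S⊆B∪B′

module Forest {n : ℕ} (G : Graph n) (acyclic : Acyclic G) where
  open Graph G using (irrefl)
  open Walks G

  -- Either the walk after its first step is a path, which acyclicity forces to retrace that step,
  -- or it has a shorter closed detour that can be cut out.
  closed-walk-weight-even : ∀ {f} → (∀ a b → f a b ≡ f b a) →
                            ∀ {a} (W : Walk G a a) → 2 ∣ weight f W
  closed-walk-weight-even {f} f-sym W = bounded (len G W) W ≤-refl
    where
    back-and-forth : ∀ {a v} (e : Adj G a v) (p : Walk G v a) → IsPath G p →
                     2 ∣ weight f (step e p)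
    back-and-forth {a} e here _ with trans (sym e) (irrefl a)
    ... | ()
    back-and-forth {a} {v} e (step _ here) _ =
      subst (2 ∣_) (cong (f a v +_) (sym (trans (+-identityʳ _) (f-sym v a)))) (2∣m+m (f a v))
    back-and-forth {a} {v} e p@(step _ (step _ _)) path =
      contradiction e (acyclic v a p path (s≤s (s≤s z≤n)))

    bounded : ∀ m {a} (W : Walk G a a) → len G W ≤ m → 2 ∣ weight f W
    bounded m here _ = 2 ∣0
    bounded (suc m) (step {a} {v} e p) (s≤s p≤m) with path-or-detour p
    ... | inj₁ path = back-and-forth e p path
    ... | inj₂ d = subst (2 ∣_) (sym weight-eq)
                    (∣m∣n⇒∣m+n (bounded m loop loop≤m) (bounded m (step e rest) rest<m))
      where
      open Detour d
      weight-eq : f a v + weight f p ≡ weight f loop + (f a v + weight f rest)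
      weight-eq = trans (cong (f a v +_) (weight-split f))
                        (x∙yz≈y∙xz (f a v) (weight f loop) (weight f rest))
      loop+rest≤m : len G loop + len G rest ≤ m
      loop+rest≤m = ≤-trans (≤-reflexive (sym len-split)) p≤m
      loop≤m : len G loop ≤ m
      loop≤m = ≤-trans (m≤m+n _ _) loop+rest≤m
      rest<m : suc (len G rest) ≤ m
      rest<m = ≤-trans (+-monoˡ-≤ (len G rest) loop-nonempty) loop+rest≤m

  closed-walk-len-even : ∀ {a} (W : Walk G a a) → 2 ∣ len G W
  closed-walk-len-even W =
    subst (2 ∣_) (sym (len≡weight W)) (closed-walk-weight-even (λ _ _ → refl) W)

module Distance {n : ℕ} (G : Graph n) (connected : Connected G) where
  open Walks G

  private
    shortest : ∀ a b → ∃[ m ] (DistLe G a b m × ∀ {j} → DistLe G a b j → m ≤ j)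
    shortest a b =
      least (λ r → DistLe? r a b) (λ i≤j D → DistLe-mono D i≤j) (connected a b , ≤-refl)

  dist : Fin n → Fin n → ℕ
  dist a b = proj₁ (shortest a b)

  dist-minimal : ∀ {a b r} → DistLe G a b r → dist a b ≤ r
  dist-minimal {a} {b} = proj₂ (proj₂ (shortest a b))

  dist≤⇒DistLe : ∀ {a b r} → dist a b ≤ r → DistLe G a b r
  dist≤⇒DistLe {a} {b} = DistLe-mono (proj₁ (proj₂ (shortest a b)))

  geodesic : ∀ a b → Σ (Walk G a b) λ p → len G p ≡ dist a b
  geodesic a b with dist≤⇒DistLe {a} {b} ≤-refl
  ... | p , p≤d = p , ≤-antisym p≤d (dist-minimal (p , ≤-refl))

  dist-triangle : ∀ a b c → dist a c ≤ dist a b + dist b c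
  dist-triangle a b c =
    dist-minimal (DistLe-++ (dist≤⇒DistLe {a} {b} ≤-refl) (dist≤⇒DistLe ≤-refl))

  dist-sym : ∀ a b → dist a b ≡ dist b a
  dist-sym a b = ≤-antisym (dist-minimal (DistLe-sym (dist≤⇒DistLe {b} {a} ≤-refl)))
                           (dist-minimal (DistLe-sym (dist≤⇒DistLe {a} {b} ≤-refl)))

  dist-refl : ∀ a → dist a a ≡ 0
  dist-refl a = n≤0⇒n≡0 (dist-minimal (here , z≤n))

  dist-step : ∀ {a b} z → Adj G a b → dist b z ≤ suc (dist a z)
  dist-step {a} {b} z e = ≤-trans (dist-triangle b a z)
    (+-monoˡ-≤ (dist a z) (dist-minimal (step (Adj-sym e) here , ≤-refl)))

  step-toward : ∀ {a x m} → dist a x ≡ suc m → ∃[ w ] (Adj G a w × dist w x ≡ m)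
  step-toward {a} {x} {m} d≡ with geodesic a x
  ... | here , p≡ = contradiction (trans p≡ d≡) (λ ())
  ... | step {v = w} e p , p≡ = w , e , ≤-antisym
    (dist-minimal (p , ≤-reflexive (suc-injective (trans p≡ d≡))))
    (≤-pred (subst (_≤ suc (dist w x)) d≡ (dist-step x (Adj-sym e))))

  has-neighbour : ∀ {u v} → u ≢ v → ∀ c → ∃[ w ] Adj G c w
  has-neighbour {u} {v} u≢v c with c ≟ᶠ u
  ... | no c≢u = first-edge (connected c u) c≢u
  ... | yes refl = first-edge (connected c v) u≢v

module Tree {n : ℕ} (G : Graph n) (connected : Connected G) (acyclic : Acyclic G) where
  open Walks G
  open Forest G acyclic
  open Distance G connected

  dist-adjacent-≢ : ∀ {u w} z → Adj G u w → dist u z ≢ dist w z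
  dist-adjacent-≢ {u} {w} z e du≡dw with geodesic u z | geodesic w z
  ... | p , p≡ | q , q≡ =
    2∤1+m+m (dist u z) (subst (2 ∣_) odd-length (closed-walk-len-even cycle))
    where
    cycle : Walk G u u
    cycle = p ++ reverse q ++ step (Adj-sym e) here
    odd-length : len G cycle ≡ suc (dist u z + dist u z)
    odd-length = begin
      len G cycle                                  ≡⟨ len-++ p _ ⟩
      len G p + len G (reverse q ++ step _ here)   ≡⟨ cong (len G p +_) (len-++ (reverse q) _) ⟩
      len G p + (len G (reverse q) + 1)            ≡⟨ cong₂ (λ i j → i + (j + 1)) p≡ q≡du ⟩
      dist u z + (dist u z + 1)                    ≡⟨ cong (dist u z +_) (+-comm _ 1) ⟩
      dist u z + suc (dist u z)                    ≡⟨ +-suc _ _ ⟩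
      suc (dist u z + dist u z)                    ∎
      where
      open ≡-Reasoning
      q≡du : len G (reverse q) ≡ dist u z
      q≡du = trans (len-reverse q) (trans q≡ (sym du≡dw))

  dist-adjacent-< : ∀ {u w} z → Adj G u w → dist w z < dist u z ⊎ dist u z < dist w z
  dist-adjacent-< {u} {w} z e with <-cmp (dist w z) (dist u z)
  ... | tri< w<u _ _ = inj₁ w<u
  ... | tri≈ _ w≡u _ = contradiction (sym w≡u) (dist-adjacent-≢ z e)
  ... | tri> _ _ u<w = inj₂ u<w

  -- A second edge between the two sides, together with geodesics that cannot use uw,
  -- would close a walk crossing uw exactly once.
  cut-edge-unique : ∀ {u w z z′} → Adj G u w → Adj G z z′ →
    dist w z < dist u z → dist u z′ < dist w z′ → z ≡ w × z′ ≡ u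
  cut-edge-unique {u} {w} {z} {z′} uw zz′ z-near-w z′-near-u with Joins? u w z′ z
  ... | yes (inj₁ (refl , refl)) = refl , refl
  ... | yes (inj₂ (refl , refl)) = contradiction (subst (dist w u <_) (dist-refl u) z-near-w) λ ()
  ... | no ¬J =
    ⊥-elim (2∤1+m+m 0 (subst (2 ∣_) crossed-once (closed-walk-weight-even (crossings-sym u w) W)))
    where
    p = proj₁ (geodesic z w)
    q = proj₁ (geodesic u z′)
    c = crossings u w
    W : Walk G z z
    W = p ++ step (Adj-sym uw) (q ++ step (Adj-sym zz′) here)
    p-uncrossed : weight c p ≡ 0
    p-uncrossed with uncrossed-or-visits u w p
    ... | inj₁ p0 = p0
    ... | inj₂ (u∈p , _) = ⊥-elim (<-irrefl refl (begin-strict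
      dist z u  ≤⟨ dist-minimal (proj₁ (visits⇒DistLe p u∈p)) ⟩
      len G p   ≡⟨ proj₂ (geodesic z w) ⟩
      dist z w  ≡⟨ dist-sym z w ⟩
      dist w z  <⟨ z-near-w ⟩
      dist u z  ≡⟨ dist-sym u z ⟩
      dist z u  ∎))
      where open ≤-Reasoning
    q-uncrossed : weight c q ≡ 0
    q-uncrossed with uncrossed-or-visits u w q
    ... | inj₁ q0 = q0
    ... | inj₂ (_ , w∈q) = ⊥-elim (<-irrefl refl (begin-strict
      dist w z′  ≤⟨ dist-minimal (proj₂ (visits⇒DistLe q w∈q)) ⟩
      len G q    ≡⟨ proj₂ (geodesic u z′) ⟩
      dist u z′  <⟨ z′-near-u ⟩
      dist w z′  ∎))
      where open ≤-Reasoning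
    crossed-once : weight c W ≡ 1
    crossed-once = begin
      ω W                                     ≡⟨ weight-++ c p _ ⟩
      ω p + (c w u + ω (q ++ step _ here))    ≡⟨ cong (λ t → ω p + (c w u + t)) (weight-++ c q _) ⟩
      ω p + (c w u + (ω q + (c z′ z + 0)))    ≡⟨ cong₂ (λ i j → i + (c w u + (j + (c z′ z + 0))))
                                                        p-uncrossed q-uncrossed ⟩
      c w u + (c z′ z + 0)                    ≡⟨ cong₂ (λ i j → i + (j + 0))
                                                        (crossings-Joins {u} {w} {w} {u} (inj₂ (refl , refl)))
                                                        (crossings-¬Joins ¬J) ⟩
      1                                       ∎
      where
      open ≡-Reasoning
      ω = weight c

  cut-walk-length : ∀ {u w x y} → Adj G u w → (p : Walk G x y) →
    dist w x < dist u x → dist u y < dist w y → dist x w + suc (dist u y) ≤ len G p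
  cut-walk-length e here x-near-w y-near-u = contradiction x-near-w (<-asym y-near-u)
  cut-walk-length {u} {w} {x} {y} e (step {v = x′} e′ p) x-near-w y-near-u with dist-adjacent-< x′ e
  ... | inj₁ x′-near-w = begin
    dist x w + suc (dist u y)         ≤⟨ +-monoˡ-≤ (suc (dist u y)) (dist-step w (Adj-sym e′)) ⟩
    suc (dist x′ w + suc (dist u y))  ≤⟨ s≤s (cut-walk-length e p x′-near-w y-near-u) ⟩
    suc (len G p)                     ∎
    where open ≤-Reasoning
  ... | inj₂ x′-near-u with cut-edge-unique e e′ x-near-w x′-near-u
  ...   | refl , refl rewrite dist-refl w = s≤s (dist-minimal (p , ≤-refl))

  cut-dist : ∀ {u w x y} → Adj G u w →
    dist w x < dist u x → dist u y < dist w y → dist x w + suc (dist u y) ≤ dist x y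
  cut-dist {x = x} {y} e x-near-w y-near-u with geodesic x y
  ... | p , p≡ = subst (_ ≤_) p≡ (cut-walk-length e p x-near-w y-near-u)

module EnclosingBall {n : ℕ} (G : Graph n) (connected : Connected G) (acyclic : Acyclic G)
                     (s : ℕ) (S : Subset n) (S-clique : IsSClique G s S) where
  open Distance G connected
  open Tree G connected acyclic

  Encloses : Fin n → ℕ → Set
  Encloses c r = ∀ x → x ∈ S → dist c x ≤ r

  tight-or-far : ∀ {c m} → Encloses c (suc m) →
    Encloses c m ⊎ ∃[ x₀ ] (x₀ ∈ S × dist c x₀ ≡ suc m)
  tight-or-far {c} {m} enc with any? (λ x → (x ∈? S) ×-dec (dist c x ≟ suc m))
  ... | yes far = inj₂ far
  ... | no ¬far = inj₁ λ x x∈S → ≤-pred (≤∧≢⇒< (enc x x∈S) (λ d≡ → ¬far (x , x∈S , d≡)))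

  -- A point of S left on c's side of the edge toward x₀ is joined to x₀ through that edge.
  step-toward-far-point : ∀ {c m x₀} → Encloses c (suc m) → x₀ ∈ S → dist c x₀ ≡ suc m →
    ∃[ w ] (Adj G c w × ∀ x → x ∈ S → dist w x ≤ m ⊎ m + suc (dist c x) ≤ s)
  step-toward-far-point {c} {m} {x₀} enc x₀∈S d≡ with step-toward d≡
  ... | w , e , dw≡ = w , e , λ x x∈S → [ inj₁ ∘ near-w x x∈S , inj₂ ∘ near-c x x∈S ]′ (dist-adjacent-< x e)
    where
    near-w : ∀ x → x ∈ S → dist w x < dist c x → dist w x ≤ m
    near-w x x∈S x-near-w = ≤-pred (≤-trans x-near-w (enc x x∈S))
    near-c : ∀ x → x ∈ S → dist c x < dist w x → m + suc (dist c x) ≤ s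
    near-c x x∈S x-near-c = begin
      m + suc (dist c x)          ≡⟨ cong (_+ suc (dist c x)) (trans (sym dw≡) (dist-sym w x₀)) ⟩
      dist x₀ w + suc (dist c x)  ≤⟨ cut-dist e x₀-near-w x-near-c ⟩
      dist x₀ x                   ≤⟨ dist-minimal (S-clique x₀ x x₀∈S x∈S) ⟩
      s                           ∎
      where
      open ≤-Reasoning
      x₀-near-w : dist w x₀ < dist c x₀
      x₀-near-w = subst₂ _<_ (sym dw≡) (sym d≡) (n<1+n m)

  Encloses-shrink : ∀ {c m} → s ≤ m + m → Encloses c (suc m) → ∃[ c′ ] Encloses c′ m
  Encloses-shrink {c} {m} s≤2m enc with tight-or-far enc
  ... | inj₁ tight = c , tight
  ... | inj₂ (x₀ , x₀∈S , d≡) with step-toward-far-point enc x₀∈S d≡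
  ...   | w , e , side = w , λ x x∈S → [ id , via-c x ]′ (side x x∈S)
    where
    via-c : ∀ x → m + suc (dist c x) ≤ s → dist w x ≤ m
    via-c x far = ≤-trans (dist-step x e) (+-cancelˡ-≤ m _ _ (≤-trans far s≤2m))

  Encloses-shrink* : ∀ {K} → s ≤ K + K → ∀ j {c} → Encloses c (j + K) → ∃[ c′ ] Encloses c′ K
  Encloses-shrink* s≤2K zero enc = _ , enc
  Encloses-shrink* {K} s≤2K (suc j) enc
    with Encloses-shrink (≤-trans s≤2K (+-mono-≤ (m≤n+m K j) (m≤n+m K j))) enc
  ... | c′ , enc′ = Encloses-shrink* s≤2K j enc′

  enclosing-ball : Fin n → ∀ {K} → s ≤ K + K → ∃[ c ] Encloses c K
  enclosing-ball v₀ {K} s≤2K with any? (_∈? S)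
  ... | yes (x₁ , x₁∈S) = Encloses-shrink* s≤2K s
    λ x x∈S → ≤-trans (dist-minimal (S-clique x₁ x x₁∈S x∈S)) (m≤m+n s K)
  ... | no S-empty = v₀ , λ x x∈S → contradiction (x , x∈S) S-empty

  split-enclosing-ball : ∀ {c k} → s ≡ k + suc k → ∃[ w ] Adj G c w → Encloses c (suc k) →
    ∃[ w ] (Adj G c w × ∀ x → x ∈ S → dist c x ≤ k ⊎ dist w x ≤ k)
  split-enclosing-ball {c} {k} s≡ (w , e) enc with tight-or-far enc
  ... | inj₁ tight = w , e , λ x x∈S → inj₁ (tight x x∈S)
  ... | inj₂ (x₀ , x₀∈S , d≡) with step-toward-far-point enc x₀∈S d≡
  ...   | w′ , e′ , side = w′ , e′ , λ x x∈S → [ inj₂ , inj₁ ∘ near-c x ]′ (side x x∈S)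
    where
    near-c : ∀ x → k + suc (dist c x) ≤ s → dist c x ≤ k
    near-c x far = ≤-pred (+-cancelˡ-≤ k _ _ (subst (k + suc (dist c x) ≤_) s≡ far))

  ball-around : Fin n → ∀ {k} → s ≡ k + k → ∃[ c ] (∀ x → x ∈ S → InBall G c k x)
  ball-around v₀ s≡ with enclosing-ball v₀ (≤-reflexive s≡)
  ... | c , enc = c , λ x x∈S → dist≤⇒DistLe (enc x x∈S)

  balls-around-edge : Fin n → (∀ c → ∃[ w ] Adj G c w) → ∀ {k} → s ≡ k + suc k →
    ∃[ c ] ∃[ w ] (Adj G c w × ∀ x → x ∈ S → InBall G c k x ⊎ InBall G w k x)
  balls-around-edge v₀ neighbour {k} s≡
    with enclosing-ball v₀ {suc k} (≤-trans (≤-reflexive s≡) (+-monoˡ-≤ (suc k) (n≤1+n k)))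
  ... | c , enc with split-enclosing-ball s≡ (neighbour c) enc
  ...   | w , e , split = c , w , e , λ x x∈S → ⊎-map dist≤⇒DistLe dist≤⇒DistLe (split x x∈S)

claim3 : ∀ {n} (G : Graph n) (s : ℕ) → 2 ≤ s → IsTree G → DiameterGt G s →
    (S : Subset n) → IsMaximalSClique G s S →
    (∀ k → s ≡ 2 * k →
      ∃[ u ] (∀ x → (x ∈ S) ⇔ InBall G u k x))
    × (∀ k → s ≡ 2 * k + 1 →
      ∃[ u ] ∃[ v ] (Adj G u v × (∀ x → (x ∈ S) ⇔ (InBall G u k x ⊎ InBall G v k x))))
claim3 G s _ (connected , acyclic) (u₀ , v₀ , u₀v₀-far) S S-maximal@(S-clique , _) = even-case , odd-case
  where
  open Distance G connected
  open Cliques G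
  open EnclosingBall G connected acyclic s S S-clique

  u₀≢v₀ : u₀ ≢ v₀
  u₀≢v₀ refl = u₀v₀-far (here , z≤n)

  even-case : ∀ k → s ≡ 2 * k → ∃[ u ] (∀ x → (x ∈ S) ⇔ InBall G u k x)
  even-case k s≡2k =
    let s≡ = trans s≡2k (2*m≡m+m k)
        (c , S⊆B) = ball-around u₀ s≡
    in c , maximal-clique-ball S-maximal s≡ S⊆B

  odd-case : ∀ k → s ≡ 2 * k + 1 →
    ∃[ u ] ∃[ v ] (Adj G u v × (∀ x → (x ∈ S) ⇔ (InBall G u k x ⊎ InBall G v k x)))
  odd-case k s≡2k+1 =
    let s≡ = trans s≡2k+1 (2*m+1≡m+[1+m] k)
        (c , w , e , S⊆B∪B′) = balls-around-edge u₀ (has-neighbour u₀≢v₀) s≡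
    in c , w , e , maximal-clique-adjacent-balls S-maximal s≡ e S⊆B∪B′
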